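{- Let $h \geq 1$ and let $\varphi(x_1,\ldots,x_h,y) = u_1x_1 + \cdots + u_hx_h + vy$ be a linear form with nonzero integer coefficients $u_1,\ldots,u_h,v$. Let $\mathcal{A} = (A_1,\ldots,A_h)$ be an $h$-tuple of nonempty finite sets of integers, let $B$ be an infinite set of integers, and let $t$ be a nonnegative integer. If the pair $(\mathcal{A},B)$ is $t$-complementing with respect to $\varphi$, then $B$ is periodic, that is, there is a positive integer $m$ such that $B$ is a union of congruence classes modulo $m$.
   Context: For an $h$-tuple $\mathcal{A}=(A_1,\ldots,A_h)$ of sets of integers and a set $B$ of integers, the representation function is $R^{(\varphi)}_{\mathcal{A},B}(n) = \mathrm{card}\{(a_1,\ldots,a_h,b) \in A_1\times\cdots\times A_h\times B : \varphi(a_1,\ldots,a_h,b) = n\}$ for $n \in \mathbf{Z}$. The pair $(\mathcal{A},B)$ is called $t$-complementing with respect to $\varphi$ if $R^{(\varphi)}_{\mathcal{A},B}(n) = t$ for all integers $n$. -}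

module Defs where

open import Level using (0ℓ)
open import Data.Nat as ℕ using (ℕ)
open import Data.Integer using (ℤ; _+_; _*_; +_; 0ℤ)
open import Data.Fin using (Fin) renaming (zero to fzero; suc to fsuc)
open import Data.Vec using (Vec; lookup)
open import Data.List using (List; length)
open import Data.List.Membership.Propositional using (_∈_)
open import Data.List.Relation.Unary.Unique.Propositional using (Unique)
open import Data.Product using (Σ; _×_; ∃; proj₁; proj₂)
open import Function.Bundles using (_⇔_)
open import Relation.Unary using (Pred)
open import Relation.Binary.PropositionalEquality using (_≡_)
open import Relation.Nullary using (¬_)

∑ : ∀ {h} → (Fin h → ℤ) → ℤ
∑ {ℕ.zero} f = 0ℤ
∑ {ℕ.suc h} f = f fzero + ∑ (λ i → f (fsuc i))

linForm : ∀ {h} → (u : Fin h → ℤ) → (v : ℤ) → Vec ℤ h → ℤ → ℤ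
linForm u v x y = ∑ (λ i → u i * lookup x i) + v * y

HasCard : {X : Set} → Pred X 0ℓ → ℕ → Set
HasCard {X} P t = Σ (List X) λ L → Unique L × length L ≡ t × (∀ x → (x ∈ L) ⇔ P x)

RepCount : ∀ {h} → (u : Fin h → ℤ) → (v : ℤ) → (A : Fin h → List ℤ) → (B : Pred ℤ 0ℓ)
         → ℤ → ℕ → Set
RepCount {h} u v A B n t =
  HasCard {Vec ℤ h × ℤ}
    (λ ab → let a = proj₁ ab ; b = proj₂ ab in
            (∀ i → lookup a i ∈ A i) × B b × linForm u v a b ≡ n)
    t

TComplementing : ∀ {h} → (u : Fin h → ℤ) → (v : ℤ) → (A : Fin h → List ℤ) → (B : Pred ℤ 0ℓ)
               → ℕ → Set
TComplementing u v A B t = ∀ n → RepCount u v A B n t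

Infinite : Pred ℤ 0ℓ → Set
Infinite B = ¬ (Σ (List ℤ) λ L → ∀ b → B b → b ∈ L)

Periodic : Pred ℤ 0ℓ → Set
Periodic B = Σ ℕ λ m → (0 ℕ.< m) × (∀ x → B x ⇔ B (x + + m))

{-# OPTIONS --safe #-}
module Submission where

-- Fix a tuple a* in the box A₁ × ⋯ × A_h at which v·(u₁a₁ + ⋯ + u_ha_h) is minimal.
-- Comparing the representations of u·a* + v·y and u·a* + v·y' shows: if B(y + d) and B(y' + d)
-- agree for the finitely many d ≠ 0 with v·d = u·a* − u·a (a in the box), then B y and B y' agree,
-- for otherwise shifting the representations of one number injects them, with room to spare,
-- into those of the other. By minimality all such d lie in [−K, −1], so membership in B is
-- determined by the preceding K values; applied to the reflected pair (𝒜, −B), which is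
-- t-complementing for u and −v, it is also determined by the following K values. Two of the
-- 2^K + 1 windows of length K ending at 0, …, 2^K coincide, and a window recurrence that runs
-- in both directions propagates this coincidence to every translate, so B is periodic.

open import Defs
open import Level using (0ℓ)
open import Data.Nat as ℕ using (ℕ; zero; suc; _≥_; _^_; z≤n; s≤s)
import Data.Nat.Properties as ℕP
open import Data.Integer using (ℤ; 0ℤ; 1ℤ; _+_; _-_; _*_; -_; +_; -[1+_]; _≤_; ∣_∣)
import Data.Integer.Properties as ℤP
open import Data.Integer.Tactic.RingSolver using (solve-∀)
open import Data.Fin using (Fin; toℕ; combine) renaming (zero to fzero; suc to fsuc)
open import Data.Fin.Properties using (pigeonhole; combine-injective)
open import Data.Vec using (Vec; lookup; tabulate)
import Data.Vec.Properties as Vec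
open import Data.List using (List; []; _∷_; length; map)
open import Data.List.Properties using (length-map; length-removeAt′)
open import Data.List.Membership.Propositional using (_∈_; _∉_)
open import Data.List.Membership.Propositional.Properties using (∈-map⁺; ∈-map⁻)
open import Data.List.Membership.DecPropositional using () renaming (_∈?_ to ∈-dec)
open import Data.List.Relation.Binary.Subset.Propositional using (_⊆_)
open import Data.List.Relation.Unary.Any using (here; there; _─_)
import Data.List.Relation.Unary.All as All
open import Data.List.Relation.Unary.All.Properties using (¬Any⇒All¬)
open import Data.List.Relation.Unary.AllPairs using (_∷_)
open import Data.List.Relation.Unary.Unique.Propositional using (Unique)
import Data.List.Relation.Unary.Unique.Propositional.Properties as Unique
open import Data.List.Extrema ℤP.≤-totalOrder
  using (argmin; argmax; argmin-all; f[argmin]≤f[⊤]; f[argmin]≤f[xs]; f[⊥]≤f[argmax]; f[xs]≤f[argmax])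
open import Data.Product using (∃-syntax; _×_; _,_; proj₁; proj₂)
import Data.Product.Properties as Product
open import Data.Sum using (inj₁; inj₂)
open import Function using (_∘_)
open import Function.Bundles using (_⇔_; mk⇔; Equivalence)
open import Relation.Binary.Definitions using (DecidableEquality)
open import Relation.Binary.PropositionalEquality
open import Relation.Nullary using (Dec; yes; no; contradiction)
open import Relation.Nullary.Decidable using (map′)
open import Relation.Unary using (Pred; Decidable)

module _ {X : Set} where

  ∈-─ : ∀ {x z : X} {ys} (p : x ∈ ys) → z ∈ ys → z ≢ x → z ∈ (ys ─ p)
  ∈-─ (here refl) (here refl) z≢x = contradiction refl z≢x
  ∈-─ (here refl) (there q)   _   = q
  ∈-─ (there p)   (here refl) _   = here refl
  ∈-─ (there p)   (there q)   z≢x = there (∈-─ p q z≢x)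

  Unique-⊆⇒length≤ : ∀ {xs ys : List X} → Unique xs → xs ⊆ ys → length xs ℕ.≤ length ys
  Unique-⊆⇒length≤ {[]}          _             _     = z≤n
  Unique-⊆⇒length≤ {x ∷ xs} {ys} (x∉xs ∷ !xs) xs⊆ys =
    subst (suc (length xs) ℕ.≤_) (sym (length-removeAt′ ys _))
      (s≤s (Unique-⊆⇒length≤ !xs λ z∈xs →
        ∈-─ (xs⊆ys (here refl)) (xs⊆ys (there z∈xs)) λ { refl → All.lookup x∉xs z∈xs refl }))

HasCard-dec : ∀ {X : Set} {P : Pred X 0ℓ} {t} → DecidableEquality X → HasCard P t → Decidable P
HasCard-dec _≟_ (L , _ , _ , L≡P) x =
  map′ (Equivalence.to (L≡P x)) (Equivalence.from (L≡P x)) (∈-dec _≟_ x L)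

module _ {X : Set} {P Q : Pred X 0ℓ} where

  HasCard-involution : (f : X → X) → (∀ x → f (f x) ≡ x) → (∀ x → P (f x) ⇔ Q x)
                     → ∀ {t} → HasCard P t → HasCard Q t
  HasCard-involution f ff≡id Pf⇔Q (L , !L , |L| , L≡P) =
    map f L , Unique.map⁺ f-injective !L , trans (length-map f L) |L| , λ x → mk⇔
      (λ x∈fL → let y , y∈L , x≡fy = ∈-map⁻ f x∈fL in
        Equivalence.to (Pf⇔Q x)
          (subst (P ∘ f) (sym x≡fy) (subst P (sym (ff≡id y)) (Equivalence.to (L≡P y) y∈L))))
      (λ Qx → subst (_∈ map f L) (ff≡id x)
        (∈-map⁺ f (Equivalence.from (L≡P (f x)) (Equivalence.from (Pf⇔Q x) Qx))))
    where
    f-injective : ∀ {x y} → f x ≡ f y → x ≡ y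
    f-injective {x} {y} fx≡fy = trans (sym (ff≡id x)) (trans (cong f fx≡fy) (ff≡id y))

module _ {X Y : Set} {P : Pred X 0ℓ} {Q : Pred Y 0ℓ} where

  HasCard-injection< : ∀ {s t} → HasCard P s → HasCard Q t
                     → (f : X → Y) → (∀ {x x'} → f x ≡ f x' → x ≡ x') → (∀ {x} → P x → Q (f x))
                     → ∀ {z} → Q z → (∀ {x} → P x → f x ≢ z) → s ℕ.< t
  HasCard-injection< (L , !L , |L| , L≡P) (M , _ , |M| , M≡Q) f f-injective P⇒Qf {z} Qz f≢z =
    subst₂ ℕ._≤_ (cong suc (trans (length-map f L) |L|)) |M|
      (Unique-⊆⇒length≤ (¬Any⇒All¬ _ z∉fL ∷ Unique.map⁺ f-injective !L) z∷fL⊆M)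
    where
    z∉fL : z ∉ map f L
    z∉fL z∈fL = let x , x∈L , z≡fx = ∈-map⁻ f z∈fL in
      f≢z (Equivalence.to (L≡P x) x∈L) (sym z≡fx)
    z∷fL⊆M : z ∷ map f L ⊆ M
    z∷fL⊆M (here refl)  = Equivalence.from (M≡Q _) Qz
    z∷fL⊆M (there w∈fL) = let x , x∈L , w≡fx = ∈-map⁻ f w∈fL in
      Equivalence.from (M≡Q _) (subst Q (sym w≡fx) (P⇒Qf (Equivalence.to (L≡P x) x∈L)))

∑-mono-≤ : ∀ {h} {f g : Fin h → ℤ} → (∀ i → f i ≤ g i) → ∑ f ≤ ∑ g
∑-mono-≤ {zero}  f≤g = ℤP.≤-refl
∑-mono-≤ {suc h} f≤g = ℤP.+-mono-≤ (f≤g fzero) (∑-mono-≤ (f≤g ∘ fsuc))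

*-distribˡ-∑ : ∀ {h} k (f : Fin h → ℤ) → k * ∑ f ≡ ∑ (λ i → k * f i)
*-distribˡ-∑ {zero}  k f = ℤP.*-zeroʳ k
*-distribˡ-∑ {suc h} k f =
  trans (ℤP.*-distribˡ-+ k (f fzero) _) (cong (λ w → k * f fzero + w) (*-distribˡ-∑ k (f ∘ fsuc)))

module _ {X : Set} (f : X → ℤ) where

  ∃-argmin : ∀ xs → xs ≢ [] → ∃[ x ] x ∈ xs × (∀ y → y ∈ xs → f x ≤ f y)
  ∃-argmin []       []≢[] = contradiction refl []≢[]
  ∃-argmin (x ∷ xs) _     =
    argmin f x xs , argmin-all f (here refl) (All.tabulate there) , λ
      { _ (here refl)  → f[argmin]≤f[⊤] {f = f} x xs
      ; _ (there y∈xs) → All.lookup (f[argmin]≤f[xs] {f = f} x xs) y∈xs }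

  ∃-upperBound : ∀ xs → ∃[ M ] (∀ y → y ∈ xs → f y ≤ M)
  ∃-upperBound []       = 0ℤ , λ _ ()
  ∃-upperBound (x ∷ xs) = f (argmax f x xs) , λ
    { _ (here refl)  → f[⊥]≤f[argmax] {f = f} x xs
    ; _ (there y∈xs) → All.lookup (f[xs]≤f[argmax] {f = f} x xs) y∈xs }

≢[]⇒∃∈ : ∀ {X : Set} {xs : List X} → xs ≢ [] → ∃[ x ] x ∈ xs
≢[]⇒∃∈ {xs = []}    []≢[] = contradiction refl []≢[]
≢[]⇒∃∈ {xs = x ∷ _} _     = x , here refl

tabulate-choice : ∀ {X : Set} {h} {P : Fin h → X → Set} → (∀ i → ∃[ x ] P i x) → ∃[ a ] (∀ i → P i (lookup a i))
tabulate-choice {P = P} choose =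
  tabulate (proj₁ ∘ choose) , λ i → subst (P i) (sym (Vec.lookup∘tabulate _ i)) (proj₂ (choose i))

module _ {h : ℕ} where

  _∈∏_ : Vec ℤ h → (Fin h → List ℤ) → Set
  a ∈∏ A = ∀ i → lookup a i ∈ A i

  ∑ᵢ : (Fin h → ℤ → ℤ) → Vec ℤ h → ℤ
  ∑ᵢ g a = ∑ λ i → g i (lookup a i)

  ∏-inhabited : ∀ {A} → (∀ i → A i ≢ []) → ∃[ a ] a ∈∏ A
  ∏-inhabited A≢[] = tabulate-choice (≢[]⇒∃∈ ∘ A≢[])

  module _ (A : Fin h → List ℤ) (g : Fin h → ℤ → ℤ) where

    ∑ᵢ-minimum : (∀ i → A i ≢ []) → ∃[ a* ] a* ∈∏ A × (∀ a → a ∈∏ A → ∑ᵢ g a* ≤ ∑ᵢ g a)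
    ∑ᵢ-minimum A≢[] =
      let a* , min = tabulate-choice λ i → ∃-argmin (g i) (A i) (A≢[] i)
      in  a* , proj₁ ∘ min , λ a a∈∏A → ∑-mono-≤ λ i → proj₂ (min i) _ (a∈∏A i)

    ∑ᵢ-upperBound : ∃[ M ] (∀ a → a ∈∏ A → ∑ᵢ g a ≤ M)
    ∑ᵢ-upperBound = ∑ (proj₁ ∘ max) , λ a a∈∏A → ∑-mono-≤ λ i → proj₂ (max i) _ (a∈∏A i)
      where
      max : ∀ i → ∃[ M ] (∀ y → y ∈ A i → g i y ≤ M)
      max i = ∃-upperBound (g i) (A i)

AgreeBelow : Pred ℤ 0ℓ → ℕ → ℤ → ℤ → Set
AgreeBelow B K y y' = ∀ n → n ℕ.< K → B (y - + suc n) ⇔ B (y' - + suc n)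

AgreeAbove : Pred ℤ 0ℓ → ℕ → ℤ → ℤ → Set
AgreeAbove B K y y' = ∀ n → n ℕ.< K → B (y + + suc n) ⇔ B (y' + + suc n)

DeterminedBelow : Pred ℤ 0ℓ → ℕ → Set
DeterminedBelow B K = ∀ y y' → AgreeBelow B K y y' → B y ⇔ B y'

DeterminedAbove : Pred ℤ 0ℓ → ℕ → Set
DeterminedAbove B K = ∀ y y' → AgreeAbove B K y y' → B y ⇔ B y'

⇔-resp-≡ : ∀ (B : Pred ℤ 0ℓ) {x x' z z'} → x ≡ z → x' ≡ z' → B x ⇔ B x' → B z ⇔ B z'
⇔-resp-≡ B = subst₂ (λ z z' → B z ⇔ B z')

DeterminedBelow-mono : ∀ {B K K'} → K ℕ.≤ K' → DeterminedBelow B K → DeterminedBelow B K'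
DeterminedBelow-mono K≤K' det y y' agree = det y y' λ n n<K → agree n (ℕP.<-≤-trans n<K K≤K')

DeterminedBelow-reflect : ∀ {B K} → DeterminedBelow (B ∘ -_) K → DeterminedAbove B K
DeterminedBelow-reflect {B} det y y' agree =
  ⇔-resp-≡ B (ℤP.neg-involutive y) (ℤP.neg-involutive y')
    (det (- y) (- y') λ n n<K →
      ⇔-resp-≡ B (sym (-[-x-a]≡x+a y (+ suc n))) (sym (-[-x-a]≡x+a y' (+ suc n))) (agree n n<K))
  where
  -[-x-a]≡x+a : ∀ x a → - (- x - a) ≡ x + a
  -[-x-a]≡x+a = solve-∀

translate : {R : ℤ → ℤ → Set}
          → (∀ y y' → R y y' → R (y + 1ℤ) (y' + 1ℤ))
          → (∀ y y' → R (y + 1ℤ) (y' + 1ℤ) → R y y')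
          → ∀ y y' → R y y' → ∀ k → R (y + k) (y' + k)
translate {R} up down y y' r (+ n)    = upward n
  where
  x+a+1≡x+[1+a] : ∀ x a → x + a + 1ℤ ≡ x + (1ℤ + a)
  x+a+1≡x+[1+a] = solve-∀
  upward : ∀ n → R (y + + n) (y' + + n)
  upward zero    = subst₂ R (sym (ℤP.+-identityʳ y)) (sym (ℤP.+-identityʳ y')) r
  upward (suc n) = subst₂ R (x+a+1≡x+[1+a] y (+ n)) (x+a+1≡x+[1+a] y' (+ n)) (up _ _ (upward n))
translate {R} up down y y' r -[1+ n ] = downward (suc n)
  where
  x-a≡x-[1+a]+1 : ∀ x a → x - a ≡ x - (1ℤ + a) + 1ℤ
  x-a≡x-[1+a]+1 = solve-∀
  downward : ∀ n → R (y - + n) (y' - + n)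
  downward zero    = subst₂ R (sym (ℤP.+-identityʳ y)) (sym (ℤP.+-identityʳ y')) r
  downward (suc n) = down _ _ (subst₂ R (x-a≡x-[1+a]+1 y (+ n)) (x-a≡x-[1+a]+1 y' (+ n)) (downward n))

x+1-[1+a]≡x-a : ∀ x a → x + 1ℤ - (1ℤ + a) ≡ x - a
x+1-[1+a]≡x-a = solve-∀

module _ {B : Pred ℤ 0ℓ} {K : ℕ} where

  AgreeBelow-suc : DeterminedBelow B K
                 → ∀ y y' → AgreeBelow B K y y' → AgreeBelow B K (y + 1ℤ) (y' + 1ℤ)
  AgreeBelow-suc det y y' agree zero    _   =
    ⇔-resp-≡ B (sym (x+1-1≡x y)) (sym (x+1-1≡x y')) (det y y' agree)
    where
    x+1-1≡x : ∀ x → x + 1ℤ - 1ℤ ≡ x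
    x+1-1≡x = solve-∀
  AgreeBelow-suc det y y' agree (suc n) n<K =
    ⇔-resp-≡ B (sym (x+1-[1+a]≡x-a y (+ suc n))) (sym (x+1-[1+a]≡x-a y' (+ suc n)))
      (agree n (ℕP.<-trans (ℕP.n<1+n n) n<K))

  AgreeBelow-pred : DeterminedAbove B K
                  → ∀ y y' → AgreeBelow B K (y + 1ℤ) (y' + 1ℤ) → AgreeBelow B K y y'
  AgreeBelow-pred det y y' agree n n<K with ℕP.m≤n⇒m<n∨m≡n n<K
  ... | inj₁ 1+n<K =
    ⇔-resp-≡ B (x+1-[1+a]≡x-a y (+ suc n)) (x+1-[1+a]≡x-a y' (+ suc n)) (agree (suc n) 1+n<K)
  -- The oldest position y − K is recovered from the K positions above it.
  ... | inj₂ refl  = det (y - + suc n) (y' - + suc n) λ l l<K →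
    let l+k≡n = ℕP.m+[n∸m]≡n (ℕP.≤-pred l<K) in
    ⇔-resp-≡ B (sym (reach y l+k≡n)) (sym (reach y' l+k≡n)) (agree (n ℕ.∸ l) (s≤s (ℕP.m∸n≤m n l)))
    where
    x-[1+a+b]+[1+a]≡x+1-[1+b] : ∀ x a b → x - (1ℤ + (a + b)) + (1ℤ + a) ≡ x + 1ℤ - (1ℤ + b)
    x-[1+a+b]+[1+a]≡x+1-[1+b] = solve-∀
    reach : ∀ x {l k} → l ℕ.+ k ≡ n → x - + suc n + + suc l ≡ x + 1ℤ - + suc k
    reach x {l} {k} refl = x-[1+a+b]+[1+a]≡x+1-[1+b] x (+ l) (+ k)

bit : ∀ {P : Set} → Dec P → Fin 2
bit (yes _) = fsuc fzero
bit (no _)  = fzero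

bit-injective : ∀ {P Q : Set} (P? : Dec P) (Q? : Dec Q) → bit P? ≡ bit Q? → P ⇔ Q
bit-injective (yes p) (yes q) _  = mk⇔ (λ _ → q) (λ _ → p)
bit-injective (no ¬p) (no ¬q) _  = mk⇔ (λ p → contradiction p ¬p) (λ q → contradiction q ¬q)
bit-injective (yes _) (no _)  ()
bit-injective (no _)  (yes _) ()

module _ {B : Pred ℤ 0ℓ} (B? : Decidable B) where

  windowCode : (K : ℕ) → ℤ → Fin (2 ^ K)
  windowCode zero    y = fzero
  windowCode (suc K) y = combine (bit (B? (y - 1ℤ))) (windowCode K (y - 1ℤ))

  windowCode-suc-injective : ∀ K {y y'} → windowCode (suc K) y ≡ windowCode (suc K) y'
    → bit (B? (y - 1ℤ)) ≡ bit (B? (y' - 1ℤ)) × windowCode K (y - 1ℤ) ≡ windowCode K (y' - 1ℤ)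
  windowCode-suc-injective K {y} = combine-injective (bit (B? (y - 1ℤ))) (windowCode K (y - 1ℤ)) _ _

  windowCode-agree : ∀ K {y y'} → windowCode K y ≡ windowCode K y' → AgreeBelow B K y y'
  windowCode-agree (suc K) {y} {y'} eq zero    _   =
    bit-injective (B? _) (B? _) (proj₁ (windowCode-suc-injective K {y} {y'} eq))
  windowCode-agree (suc K) {y} {y'} eq (suc n) n<K =
    ⇔-resp-≡ B (x-1-a≡x-[1+a] y (+ suc n)) (x-1-a≡x-[1+a] y' (+ suc n))
      (windowCode-agree K (proj₂ (windowCode-suc-injective K {y} {y'} eq)) n (ℕ.s≤s⁻¹ n<K))
    where
    x-1-a≡x-[1+a] : ∀ x a → x - 1ℤ - a ≡ x - (1ℤ + a)
    x-1-a≡x-[1+a] = solve-∀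

  agreeing-translates : ∀ K → ∃[ i ] ∃[ m ] 0 ℕ.< m × AgreeBelow B K (+ i) (+ i + + m)
  agreeing-translates K with pigeonhole (ℕP.n<1+n (2 ^ K)) (windowCode K ∘ +_ ∘ toℕ)
  ... | i , j , i<j , eq = toℕ i , toℕ j ℕ.∸ toℕ i , ℕP.m<n⇒0<n∸m i<j ,
        subst (AgreeBelow B K (+ toℕ i) ∘ +_) (sym (ℕP.m+[n∸m]≡n (ℕP.<⇒≤ i<j))) (windowCode-agree K eq)

  periodic : ∀ {K} → DeterminedBelow B K → DeterminedAbove B K → Periodic B
  periodic {K} below above with agreeing-translates K
  ... | i , m , 0<m , agree = m , 0<m , λ x →
        below x (x + + m) (subst₂ (AgreeBelow B K) (a+[x-a]≡x x (+ i)) (a+m+[x-a]≡x+m x (+ i) (+ m))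
          (translate (AgreeBelow-suc below) (AgreeBelow-pred above) (+ i) (+ i + + m) agree (x - + i)))
    where
    a+[x-a]≡x : ∀ x a → a + (x - a) ≡ x
    a+[x-a]≡x = solve-∀
    a+m+[x-a]≡x+m : ∀ x a m → a + m + (x - a) ≡ x + m
    a+m+[x-a]≡x+m = solve-∀

infix 8 _·_

_·_ : ∀ {h} → (Fin h → ℤ) → Vec ℤ h → ℤ
u · a = ∑ᵢ (λ i → u i *_) a

linear-shift : ∀ v d s s* y → s + v * (y + d) ≡ s* + v * y ⇔ v * d ≡ s* - s
linear-shift v d s s* y = mk⇔
  (λ eq → begin
    v * d                             ≡⟨ expand v d s y ⟩
    s + v * (y + d) - s - v * y       ≡⟨ cong (λ w → w - s - v * y) eq ⟩
    s* + v * y - s - v * y            ≡⟨ cancel s s* (v * y) ⟩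
    s* - s                            ∎)
  (λ vd → begin
    s + v * (y + d)                   ≡⟨ distrib v d s y ⟩
    v * y + (s + v * d)               ≡⟨ cong (λ w → v * y + (s + w)) vd ⟩
    v * y + (s + (s* - s))            ≡⟨ collect s s* (v * y) ⟩
    s* + v * y                        ∎)
  where
  open ≡-Reasoning
  expand : ∀ v d s y → v * d ≡ s + v * (y + d) - s - v * y
  expand = solve-∀
  cancel : ∀ s s* w → s* + w - s - w ≡ s* - s
  cancel = solve-∀
  distrib : ∀ v d s y → s + v * (y + d) ≡ v * y + (s + v * d)
  distrib = solve-∀
  collect : ∀ s s* w → w + (s + (s* - s)) ≡ s* + w
  collect = solve-∀

square-positive : ∀ {v} → v ≢ 0ℤ → ∃[ k ] v * v ≡ + suc k
square-positive {+ zero}    v≢0 = contradiction refl v≢0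
square-positive {+ suc j}   _   = _ , refl
square-positive { -[1+ j ]} _   = _ , refl

positive-window : ∀ {c e K} → 0ℤ ≤ + suc c * e → + suc c * e ≤ + K → e ≢ 0ℤ
                → ∃[ n ] n ℕ.< K × e ≡ + suc n
positive-window {e = + zero}      _  _  e≢0 = contradiction refl e≢0
positive-window {c} {e = + suc n} _  ≤K _   =
  n , ℕP.≤-trans (ℕP.m≤n*m (suc n) (suc c)) (ℤP.drop‿+≤+ ≤K) , refl
positive-window {e = -[1+ n ]}    () _  _

square-spread : ∀ v d s s* → v * d ≡ s* - s → v * v * - d ≡ v * s - v * s*
square-spread v d s s* vd = trans (nest v d) (trans (cong (λ w → - (v * w)) vd) (spread v s s*))
  where
  nest : ∀ v d → v * v * - d ≡ - (v * (v * d))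
  nest = solve-∀
  spread : ∀ v s s* → - (v * (s* - s)) ≡ v * s - v * s*
  spread = solve-∀

module _ {h : ℕ} (u : Fin h → ℤ) (v : ℤ) (A : Fin h → List ℤ) where

  Admissible : Vec ℤ h → ℤ → Set
  Admissible a* d = d ≢ 0ℤ × ∃[ a ] a ∈∏ A × v * d ≡ u · a* - u · a

  admissible-window : v ≢ 0ℤ → (∀ i → A i ≢ [])
    → ∃[ a* ] a* ∈∏ A × ∃[ K ] (∀ d → Admissible a* d → ∃[ n ] n ℕ.< K × d ≡ -[1+ n ])
  admissible-window v≢0 A≢[] = a* , a*∈∏A , ∣ M - key a* ∣ , window
    where
    g : Fin h → ℤ → ℤ
    g i x = v * (u i * x)
    key : Vec ℤ h → ℤ
    key = ∑ᵢ g
    key≡ : ∀ a → key a ≡ v * u · a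
    key≡ a = sym (*-distribˡ-∑ v (λ i → u i * lookup a i))
    minimum = ∑ᵢ-minimum A g A≢[]
    a* = proj₁ minimum
    a*∈∏A = proj₁ (proj₂ minimum)
    M = proj₁ (∑ᵢ-upperBound A g)
    ≤M : ∀ a → a ∈∏ A → key a ≤ M
    ≤M = proj₂ (∑ᵢ-upperBound A g)
    window : ∀ d → Admissible a* d → ∃[ n ] n ℕ.< ∣ M - key a* ∣ × d ≡ -[1+ n ]
    window d (d≢0 , a , a∈∏A , vd) =
      let n , n<K , -d≡ = positive-window {c} { - d} (subst (0ℤ ≤_) spread lower) (subst₂ _≤_ spread +K≡ upper) -d≢0
      in  n , n<K , trans (sym (ℤP.neg-involutive d)) (cong -_ -d≡)
      where
      c = proj₁ (square-positive v≢0)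
      spread : key a - key a* ≡ + suc c * - d
      spread = begin
        key a - key a*           ≡⟨ cong₂ _-_ (key≡ a) (key≡ a*) ⟩
        v * u · a - v * u · a*   ≡⟨ sym (square-spread v d (u · a) (u · a*) vd) ⟩
        v * v * - d              ≡⟨ cong (_* - d) (proj₂ (square-positive v≢0)) ⟩
        + suc c * - d            ∎
        where open ≡-Reasoning
      lower : 0ℤ ≤ key a - key a*
      lower = ℤP.i≤j⇒0≤j-i (proj₂ (proj₂ minimum) a a∈∏A)
      upper : key a - key a* ≤ M - key a*
      upper = ℤP.+-monoˡ-≤ (- key a*) (≤M a a∈∏A)
      +K≡ : M - key a* ≡ + ∣ M - key a* ∣
      +K≡ = sym (ℤP.0≤i⇒+∣i∣≡i (ℤP.i≤j⇒0≤j-i (≤M a* a*∈∏A)))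
      -d≢0 : - d ≢ 0ℤ
      -d≢0 -d≡0 = d≢0 (trans (sym (ℤP.neg-involutive d)) (cong -_ -d≡0))

  module _ {B : Pred ℤ 0ℓ} {t : ℕ} where

    TComplementing-reflect : TComplementing u v A B t → TComplementing u (- v) A (B ∘ -_) t
    TComplementing-reflect tc n = HasCard-involution reflect reflect-involutive reflect-rep (tc n)
      where
      reflect : Vec ℤ h × ℤ → Vec ℤ h × ℤ
      reflect (a , b) = a , - b
      reflect-involutive : ∀ ab → reflect (reflect ab) ≡ ab
      reflect-involutive (a , b) = cong (a ,_) (ℤP.neg-involutive b)
      v*-b≡-v*b : ∀ b → v * - b ≡ - v * b
      v*-b≡-v*b b = trans (sym (ℤP.neg-distribʳ-* v b)) (ℤP.neg-distribˡ-* v b)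
      reflect-rep : ∀ ab → _ ⇔ _
      reflect-rep (a , b) = mk⇔
        (λ (a∈∏A , B-b , eq) → a∈∏A , B-b , trans (cong (λ w → u · a + w) (sym (v*-b≡-v*b b))) eq)
        (λ (a∈∏A , B-b , eq) → a∈∏A , B-b , trans (cong (λ w → u · a + w) (v*-b≡-v*b b)) eq)

    Represents : ℤ → Vec ℤ h × ℤ → Set
    Represents n ab = proj₁ ab ∈∏ A × B (proj₂ ab) × u · proj₁ ab + v * proj₂ ab ≡ n

    module _ (tc : TComplementing u v A B t) where

      B-decidable : ∀ {a₀} → a₀ ∈∏ A → Decidable B
      B-decidable {a₀} a₀∈∏A y =
        map′ (proj₁ ∘ proj₂) represent (HasCard-dec _≟_ (tc (u · a₀ + v * y)) (a₀ , y))
        where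
        represent : B y → Represents (u · a₀ + v * y) (a₀ , y)
        represent By = a₀∈∏A , By , refl
        _≟_ = Product.≡-dec (Vec.≡-dec ℤP._≟_) ℤP._≟_

      shift : ∀ {a* y y'} → a* ∈∏ A → (∀ d → Admissible a* d → B (y' + d) → B (y + d)) → B y → B y'
      shift {a*} {y} {y'} a*∈∏A H By with B-decidable {a*} a*∈∏A y'
      ... | yes By' = By'
      ... | no ¬By' = contradiction
            (HasCard-injection< (tc (u · a* + v * y')) (tc (u · a* + v * y)) move move-injective
               (λ {p} → move-rep {p}) {z = a* , y} (a*∈∏A , By , refl) (λ {p} → move≢ {p}))
            (ℕP.<-irrefl refl)
        where
        move : Vec ℤ h × ℤ → Vec ℤ h × ℤ
        move (a , b) = a , y + (b - y')
        unmove : ∀ b → b ≡ y' + (proj₂ (move (a* , b)) - y)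
        unmove b = b≡y'+[y+[b-y']-y] y y' b
          where
          b≡y'+[y+[b-y']-y] : ∀ y y' b → b ≡ y' + (y + (b - y') - y)
          b≡y'+[y+[b-y']-y] = solve-∀
        move-injective : ∀ {p q} → move p ≡ move q → p ≡ q
        move-injective {a , b} {a' , b'} eq = cong₂ _,_ (cong proj₁ eq)
          (trans (unmove b) (trans (cong (λ w → y' + (w - y)) (cong proj₂ eq)) (sym (unmove b'))))
        move≢ : ∀ {p} → Represents (u · a* + v * y') p → move p ≢ (a* , y)
        move≢ {a , b} (_ , Bb , _) eq =
          ¬By' (subst B (trans (unmove b) (trans (cong (λ w → y' + (w - y)) (cong proj₂ eq)) (y'+[y-y]≡y' y y'))) Bb)
          where
          y'+[y-y]≡y' : ∀ y y' → y' + (y - y) ≡ y'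
          y'+[y-y]≡y' = solve-∀
        move-rep : ∀ {p} → Represents (u · a* + v * y') p → Represents (u · a* + v * y) (move p)
        move-rep {a , b} (a∈∏A , Bb , eq) =
          a∈∏A , H d (d≢0 , a , a∈∏A , vd) (subst B (sym y'+d≡b) Bb) ,
          Equivalence.from (linear-shift v d (u · a) (u · a*) y) vd
          where
          d = b - y'
          y'+d≡b : y' + d ≡ b
          y'+d≡b = y'+[b-y']≡b y' b
            where
            y'+[b-y']≡b : ∀ y' b → y' + (b - y') ≡ b
            y'+[b-y']≡b = solve-∀
          vd : v * d ≡ u · a* - u · a
          vd = Equivalence.to (linear-shift v d (u · a) (u · a*) y')
                 (trans (cong (λ w → u · a + v * w) y'+d≡b) eq)
          d≢0 : d ≢ 0ℤ
          d≢0 d≡0 = ¬By' (subst B (ℤP.i-j≡0⇒i≡j b y' d≡0) Bb)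

      DeterminedBelow-from-window : ∀ {a* K} → a* ∈∏ A
        → (∀ d → Admissible a* d → ∃[ n ] n ℕ.< K × d ≡ -[1+ n ])
        → DeterminedBelow B K
      DeterminedBelow-from-window {a*} {K} a*∈∏A window y y' agree = mk⇔
        (shift {a*} {y} {y'} a*∈∏A (transfer y' y λ n n<K → Equivalence.from (agree n n<K)))
        (shift {a*} {y'} {y} a*∈∏A (transfer y y' λ n n<K → Equivalence.to (agree n n<K)))
        where
        transfer : ∀ y y' → (∀ n → n ℕ.< K → B (y - + suc n) → B (y' - + suc n))
                 → ∀ d → Admissible a* d → B (y + d) → B (y' + d)
        transfer y y' step d adm with window d adm
        ... | n , n<K , refl = step n n<K

      determinedBelow : v ≢ 0ℤ → (∀ i → A i ≢ []) → ∃[ K ] DeterminedBelow B K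
      determinedBelow v≢0 A≢[] =
        let a* , a*∈∏A , K , window = admissible-window v≢0 A≢[]
        in  K , DeterminedBelow-from-window {a*} a*∈∏A window

mainTheorem1 : (h : ℕ) → h ≥ 1 → (u : Fin h → ℤ) → (v : ℤ)
               → (∀ i → u i ≢ 0ℤ) → v ≢ 0ℤ
               → (A : Fin h → List ℤ) → (∀ i → Unique (A i)) → (∀ i → A i ≢ [])
               → (B : Pred ℤ 0ℓ) → Infinite B
               → (t : ℕ) → TComplementing u v A B t
               → Periodic B
mainTheorem1 h _ u v _ v≢0 A _ A≢[] B _ t tc =
  let a₀ , a₀∈∏A = ∏-inhabited A≢[]
      K₁ , below = determinedBelow u v A tc v≢0 A≢[]
      K₂ , above = determinedBelow u (- v) A (TComplementing-reflect u v A tc) (v≢0 ∘ ℤP.neg-injective) A≢[]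
  in  periodic (B-decidable u v A tc {a₀} a₀∈∏A)
        (DeterminedBelow-mono (ℕP.m≤m+n K₁ K₂) below)
        (DeterminedBelow-reflect (DeterminedBelow-mono (ℕP.m≤n+m K₂ K₁) above))
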